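{- Let $k$ be a number field, $m\geq n\geq1$, and let $0\leq r,\ell\leq n-1$ with $r\neq\ell$. Then $C_{(m-r)n}(\underline{b_r})\neq C_{(m-\ell)n}(\underline{b_\ell})$.
   Context: $P_{mn-1,1}(k)$ is the parabolic of $\mathrm{GL}_{mn}(k)$ of matrices $\begin{pmatrix}A&X\\0&d\end{pmatrix}$, $A\in\mathrm{GL}_{mn-1}(k)$, $d\in k^\times$. $T_{m,n}(k)$ is the image of the Kronecker product $t:\mathrm{GL}_m(k)\times\mathrm{GL}_n(k)\to\mathrm{GL}_{mn}(k)$, $t(h,g)$ being the block matrix with $(i,j)$ block $h_{ij}g$. For $1\leq j\leq mn$, $w_j=\begin{pmatrix}I_{j-1}&&\\&&I_{mn-j}\\&1&\end{pmatrix}$, and for a row vector $\underline{v}\in k^{mn-j}$, $u_j(\underline{v})=\begin{pmatrix}I_{j-1}&0&0\\&1&\underline{v}\\&&I_{mn-j}\end{pmatrix}$; $C_j(\underline{v})=P_{mn-1,1}(k)w_ju_j(\underline{v})T_{m,n}(k)$. With $e_1,\dots,e_n$ the standard column basis of $k^n$, $\underline{b_r}=(e_{n-1}^T,\dots,e_{n-r}^T)\in k^{rn}$. -}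

module Defs where

open import Level using (Level; _⊔_) renaming (suc to lsuc)
open import Algebra.Bundles using (CommutativeRing)
open import Data.Nat as ℕ using (ℕ; zero; suc; _∸_; _≤_; _<_; _≤?_; _<?_)
open import Data.Fin as Fin using (Fin; toℕ; remQuot)
open import Data.Product using (Σ; ∃; _×_; _,_; proj₁; proj₂)
open import Data.Bool using (if_then_else_; _∧_)
open import Relation.Nullary using (¬_; does)
open import Relation.Binary.PropositionalEquality using (_≡_)
open import Data.Rational as ℚ using (ℚ; 0ℚ; 1ℚ)

record Field (c ℓ : Level) : Set (lsuc (c ⊔ ℓ)) where
  field
    commutativeRing : CommutativeRing c ℓ
  open CommutativeRing commutativeRing public
  field
    0≉1     : ¬ (0# ≈ 1#)
    inverse : ∀ x → ¬ (x ≈ 0#) → ∃ λ y → (x * y) ≈ 1#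

module FieldTheory {c ℓ : Level} (F : Field c ℓ) where
  open Field F

  ∑ : ∀ {d} → (Fin d → Carrier) → Carrier
  ∑ {zero}  f = 0#
  ∑ {suc d} f = f Fin.zero + ∑ (λ i → f (Fin.suc i))

  record IsNumberField : Set (c ⊔ ℓ) where
    field
      φ       : ℚ → Carrier
      φ-+     : ∀ p q → φ (p ℚ.+ q) ≈ (φ p + φ q)
      φ-*     : ∀ p q → φ (p ℚ.* q) ≈ (φ p * φ q)
      φ-1     : φ 1ℚ ≈ 1#
      degree  : ℕ
      basis   : Fin degree → Carrier
      spans   : ∀ x → ∃ λ (a : Fin degree → ℚ) → x ≈ ∑ (λ i → φ (a i) * basis i)
      indep   : ∀ (a : Fin degree → ℚ) → ∑ (λ i → φ (a i) * basis i) ≈ 0# →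
                ∀ i → a i ≡ 0ℚ

  Mat : ℕ → Set c
  Mat N = Fin N → Fin N → Carrier

  _≈M_ : ∀ {N} → Mat N → Mat N → Set ℓ
  A ≈M B = ∀ i j → A i j ≈ B i j

  _⊗_ : ∀ {N} → Mat N → Mat N → Mat N
  (A ⊗ B) i j = ∑ (λ k → A i k * B k j)

  δ : ∀ {N} → Fin N → Fin N → Carrier
  δ i j = if does (toℕ i ℕ.≟ toℕ j) then 1# else 0#

  I : ∀ {N} → Mat N
  I = δ

  InGL : ∀ {N} → Mat N → Set (c ⊔ ℓ)
  InGL {N} A = ∃ λ (B : Mat N) → ((A ⊗ B) ≈M I) × ((B ⊗ A) ≈M I)

  InP : ∀ {N} → Mat N → Set (c ⊔ ℓ)
  InP {N} A = InGL A ×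
    (∀ i j → toℕ i ≡ N ∸ 1 → toℕ j < N ∸ 1 → A i j ≈ 0#)

  -- Kronecker product t(h,g): the (a,a') block is h_{a a'} g.
  -- Row index i of Fin (m*n) corresponds to block a and inner index b via remQuot.
  kron : ∀ {m n} → Mat m → Mat n → Mat (m ℕ.* n)
  kron {m} {n} h g i j =
    h (proj₁ (remQuot {m} n i)) (proj₁ (remQuot {m} n j)) *
    g (proj₂ (remQuot {m} n i)) (proj₂ (remQuot {m} n j))

  InT : ∀ m n → Mat (m ℕ.* n) → Set (c ⊔ ℓ)
  InT m n A = ∃ λ (h : Mat m) → ∃ λ (g : Mat n) →
    InGL h × InGL g × (A ≈M kron h g)

  -- w_j (j is 1-based).  0-based: row i has its 1 in column σ(i), where
  -- σ(i) = i for i < j-1, σ(i) = i+1 for j-1 ≤ i < N-1, σ(N-1) = j-1.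
  σw : ℕ → ℕ → ℕ → ℕ
  σw N j i = if does (i <? j ∸ 1) then i
             else (if does (i <? N ∸ 1) then suc i else j ∸ 1)

  w : ∀ {N} → ℕ → Mat N
  w {N} j i k = if does (toℕ k ℕ.≟ σw N j (toℕ i)) then 1# else 0#

  -- u_j(v) (j is 1-based): identity matrix with row j replaced by (0,…,0,1,v).
  -- The row vector v ∈ k^{N-j} is given as a function ℕ → k of which only the
  -- entries 0 … N-j-1 are used (v p is the (p+1)-th coordinate).
  u : ∀ {N} → ℕ → (ℕ → Carrier) → Mat N
  u j v i k = if does (toℕ i ℕ.≟ j ∸ 1) ∧ does (j ≤? toℕ k)
              then v (toℕ k ∸ j) else δ i k

  InC : ∀ m n → ℕ → (ℕ → Carrier) → Mat (m ℕ.* n) → Set (c ⊔ ℓ)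
  InC m n j v g = ∃ λ p → ∃ λ t → InP p × InT m n t ×
    (g ≈M (((p ⊗ w j) ⊗ u j v) ⊗ t))

  -- standard basis vector e_i (1-based) of k^n, as a row: coordinate q (0-based)
  -- is 1 iff q + 1 = i
  e : ℕ → ℕ → Carrier
  e i q = if does (suc q ℕ.≟ i) then 1# else 0#

  -- b_r = (e_{n-1}^T, …, e_{n-r}^T) ∈ k^{rn}, coordinates indexed from 0;
  -- b_{r+1} is b_r followed by the block e_{n-(r+1)}^T.
  b : ℕ → ℕ → ℕ → Carrier
  b n zero    p = 0#
  b n (suc r) p = if does (p <? r ℕ.* n) then b n r p
                  else e (n ∸ suc r) (p ∸ r ℕ.* n)

module Submission where

-- Read a row vector of length mn as an m × n matrix, its a-th block being row a; right multiplication by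
-- t(h,g) then becomes Y ↦ hᵀ Y g. The last row of p w_j u_j(v) t(h,g) is d · (row j of u_j(v)) · t(h,g),
-- d being the corner entry of p ∈ P. For j = (m-r)n and v = b_r, row j of u_j(v) is (0,…,0,1,b_r), whose
-- matrix vanishes outside its last r+1 rows, so every element of C_{(m-r)n}(b_r) has a last row of rank at
-- most r+1. On the other hand w_j u_j(b_l) ∈ C_{(m-l)n}(b_l) with j = (m-l)n has last row (0,…,0,1,b_l),
-- whose matrix ends in the rows e_n, e_{n-1}, …, e_{n-l}: an (l+1) × (l+1) identity minor. Hence
-- C_{(m-l)n}(b_l) ⊆ C_{(m-r)n}(b_r) forces l ≤ r, and two equal cosets force r = l.

open import Algebra.Bundles using (Semiring)
open import Data.Bool using (if_then_else_; _∧_)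
open import Data.Empty using (⊥-elim)
open import Data.Fin as Fin using (Fin; zero; suc; toℕ; combine; cast; fromℕ<; _↑ˡ_; _↑ʳ_; punchIn)
import Data.Fin.Properties as Fin
open import Data.Nat as ℕ using (ℕ; zero; suc; _≤_; _<_; z≤n; s≤s)
import Data.Nat.Properties as ℕ
open import Data.Nat.Tactic.RingSolver using (solve-∀)
open import Data.Product using (∃; ∃₂; _×_; _,_; proj₁; proj₂)
open import Data.Sum using (inj₁; inj₂)
open import Function using (_∘_)
open import Level using (Level; _⊔_)
open import Relation.Nullary using (¬_; Dec; does)
open import Relation.Nullary.Decidable using (dec-true; dec-false; does-≡; map′; decidable-stable)
open import Relation.Binary.PropositionalEquality as ≡ using (_≡_; _≢_)

open import Defs

¬¬-∀-Fin : ∀ {n p} {P : Fin n → Set p} → (∀ k → ¬ ¬ P k) → ¬ ¬ (∀ k → P k)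
¬¬-∀-Fin {zero}  ¬¬P ¬∀P = ¬∀P (λ ())
¬¬-∀-Fin {suc n} ¬¬P ¬∀P = ¬¬P zero λ P₀ →
  ¬¬-∀-Fin (¬¬P ∘ suc) λ P₊ → ¬∀P λ { zero → P₀ ; (suc k) → P₊ k }

module _ {a p} {A : Set a} {P : Set p} {x y : A} where

  if-yes : (P? : Dec P) → P → (if does P? then x else y) ≡ x
  if-yes P? p = ≡.cong (if_then x else y) (dec-true P? p)

  if-no : (P? : Dec P) → ¬ P → (if does P? then x else y) ≡ y
  if-no P? ¬p = ≡.cong (if_then x else y) (dec-false P? ¬p)

  if-⇔ : ∀ {q} {Q : Set q} (P? : Dec P) (Q? : Dec Q) → (P → Q) → (Q → P) →
         (if does P? then x else y) ≡ (if does Q? then x else y)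
  if-⇔ P? Q? P→Q Q→P = ≡.cong (if_then x else y) (does-≡ P? (map′ Q→P P→Q Q?))

∸-decomposition : ∀ {l m} → l < m → ∃ λ A → A ℕ.+ suc l ≡ m × m ℕ.∸ l ≡ suc A
∸-decomposition {zero}  {suc m} _ = m , ℕ.+-comm m 1 , ≡.refl
∸-decomposition {suc l} {suc m} (s≤s l<m) with A , A+1+l≡m , m∸l≡1+A ← ∸-decomposition l<m =
  A , ≡.trans (ℕ.+-suc A (suc l)) (≡.cong suc A+1+l≡m) , m∸l≡1+A

∸1< : ∀ {j N} → 1 ≤ j → j ≤ N → j ℕ.∸ 1 < N
∸1< {suc j} _ j≤N = j≤N

suc≤+suc : ∀ A l → suc A ≤ A ℕ.+ suc l
suc≤+suc A l = ≡.subst (suc A ≤_) (≡.sym (ℕ.+-suc A l)) (s≤s (ℕ.m≤m+n A l))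

lastOfBlock : ∀ n1 A → n1 ℕ.+ A ℕ.* suc n1 ≡ suc n1 ℕ.* (A ℕ.+ 0) ℕ.+ n1
lastOfBlock = solve-∀

laterBlock : ∀ n1 A s x →
             suc n1 ℕ.* (A ℕ.+ suc s) ℕ.+ x ≡ suc A ℕ.* suc n1 ℕ.+ (s ℕ.* suc n1 ℕ.+ x)
laterBlock = solve-∀

earlierBlock : ∀ n1 {a D x} → a < D → x ≤ n1 → suc n1 ℕ.* a ℕ.+ x < n1 ℕ.+ D ℕ.* suc n1
earlierBlock n1 {a} {D} {x} a<D x≤n1 = begin-strict
  suc n1 ℕ.* a ℕ.+ x   ≤⟨ ℕ.+-monoʳ-≤ (suc n1 ℕ.* a) x≤n1 ⟩
  suc n1 ℕ.* a ℕ.+ n1  ≡⟨ ℕ.+-comm (suc n1 ℕ.* a) n1 ⟩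
  n1 ℕ.+ suc n1 ℕ.* a  <⟨ ℕ.+-monoʳ-< n1 (ℕ.*-monoʳ-< (suc n1) a<D) ⟩
  n1 ℕ.+ suc n1 ℕ.* D  ≡⟨ ≡.cong (n1 ℕ.+_) (ℕ.*-comm (suc n1) D) ⟩
  n1 ℕ.+ D ℕ.* suc n1  ∎
  where open ℕ.≤-Reasoning

blockIndex< : ∀ n {s l x} → s < l → x < n → s ℕ.* n ℕ.+ x < l ℕ.* n
blockIndex< n {s} {l} {x} s<l x<n = begin-strict
  s ℕ.* n ℕ.+ x  <⟨ ℕ.+-monoʳ-< (s ℕ.* n) x<n ⟩
  s ℕ.* n ℕ.+ n  ≡⟨ ℕ.+-comm (s ℕ.* n) n ⟩
  suc s ℕ.* n    ≤⟨ ℕ.*-monoˡ-≤ n s<l ⟩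
  l ℕ.* n        ∎
  where open ℕ.≤-Reasoning

reflectedIndex-injective : ∀ {n1 t t′} → t ≤ n1 → t′ ≤ n1 →
                           suc (n1 ℕ.∸ t′) ≡ suc n1 ℕ.∸ t → t ≡ t′
reflectedIndex-injective t≤n1 t′≤n1 eq =
  ≡.sym (ℕ.∸-cancelˡ-≡ t′≤n1 t≤n1 (ℕ.suc-injective (≡.trans eq (ℕ.+-∸-assoc 1 t≤n1))))

reflectedIndex-refl : ∀ {n1 t} → t ≤ n1 → suc (n1 ℕ.∸ t) ≡ suc n1 ℕ.∸ t
reflectedIndex-refl t≤n1 = ≡.sym (ℕ.+-∸-assoc 1 t≤n1)

minorRow : ∀ A {l} → Fin (suc l) → Fin (A ℕ.+ suc l)
minorRow A t = fromℕ< (ℕ.+-monoʳ-< A (Fin.toℕ<n t))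

minorCol : ∀ n1 {l} → Fin (suc l) → Fin (suc n1)
minorCol n1 t′ = fromℕ< (s≤s (ℕ.m∸n≤m n1 (toℕ t′)))

toℕ-minorRow : ∀ A {l} (t : Fin (suc l)) → toℕ (minorRow A t) ≡ A ℕ.+ toℕ t
toℕ-minorRow A t = Fin.toℕ-fromℕ< _

toℕ-minorCol : ∀ n1 {l} (t′ : Fin (suc l)) → toℕ (minorCol n1 t′) ≡ n1 ℕ.∸ toℕ t′
toℕ-minorCol n1 t′ = Fin.toℕ-fromℕ< _

module FiniteSums {c ℓ} (R : Semiring c ℓ) where
  open Semiring R
  open import Algebra.Properties.Semiring.Sum R public
  open import Relation.Binary.Reasoning.Setoid setoid

  sum-zero : ∀ {n} {f : Fin n → Carrier} → (∀ i → f i ≈ 0#) → sum f ≈ 0#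
  sum-zero {n} f≈0 = trans (sum-cong-≋ f≈0) (sum-replicate-zero n)

  sum-single : ∀ {n} {f : Fin n → Carrier} i → (∀ k → k ≢ i → f k ≈ 0#) → sum f ≈ f i
  sum-single {suc n} {f} i f≈0 = begin
    sum f                              ≈⟨ sum-remove f ⟩
    f i + sum (λ k → f (punchIn i k))  ≈⟨ +-congˡ (sum-zero (λ k → f≈0 _ (Fin.punchInᵢ≢i i k))) ⟩
    f i + 0#                           ≈⟨ +-identityʳ (f i) ⟩
    f i                                ∎

  sum-splitAt : ∀ m {n} (f : Fin (m ℕ.+ n) → Carrier) →
                sum f ≈ sum (λ i → f (i ↑ˡ n)) + sum (λ j → f (m ↑ʳ j))
  sum-splitAt zero    f = sym (+-identityˡ _)
  sum-splitAt (suc m) f = trans (+-congˡ (sum-splitAt m (f ∘ suc))) (sym (+-assoc _ _ _))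

  sum-combine : ∀ m {n} (f : Fin (m ℕ.* n) → Carrier) →
                sum f ≈ sum (λ a → sum (λ o → f (combine {m} {n} a o)))
  sum-combine zero        f = refl
  sum-combine (suc m) {n} f =
    trans (sum-splitAt n f) (+-congˡ (sum-combine m {n} (λ i → f (n ↑ʳ i))))

  sum-cast : ∀ {m n} (eq : m ≡ n) (f : Fin n → Carrier) → sum f ≈ sum (f ∘ cast eq)
  sum-cast ≡.refl f = reflexive (sum-cong-≗ (λ i → ≡.cong f (≡.sym (Fin.cast-is-id ≡.refl i))))

  sum-dropInitial : ∀ d {p n} (eq : d ℕ.+ p ≡ n) (f : Fin n → Carrier) →
                    (∀ a → toℕ a < d → f a ≈ 0#) → sum f ≈ sum (λ s → f (cast eq (d ↑ʳ s)))
  sum-dropInitial d {p} eq f f≈0 = begin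
    sum f                                          ≈⟨ sum-cast eq f ⟩
    sum (f ∘ cast eq)                              ≈⟨ sum-splitAt d _ ⟩
    sum (λ i → f (cast eq (i ↑ˡ p))) + sum final   ≈⟨ +-congʳ (sum-zero (λ i → f≈0 _ (initial i))) ⟩
    0# + sum final                                 ≈⟨ +-identityˡ _ ⟩
    sum final                                      ∎
    where
    final : Fin p → Carrier
    final s = f (cast eq (d ↑ʳ s))
    initial : ∀ i → toℕ (cast eq (i ↑ˡ p)) < d
    initial i = ≡.subst (_< d) (≡.sym (≡.trans (Fin.toℕ-cast eq _) (Fin.toℕ-↑ˡ i p))) (Fin.toℕ<n i)

module Rank {c ℓ} (F : Field c ℓ) where
  open Field F hiding (zero)
  open FieldTheory F using (δ)
  open FiniteSums semiring
  open import Relation.Binary.Reasoning.Setoid setoid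

  Matrix : ℕ → ℕ → Set c
  Matrix q p = Fin q → Fin p → Carrier

  IdentityFactorsThrough : ℕ → ℕ → Set (c ⊔ ℓ)
  IdentityFactorsThrough q p =
    ∃₂ λ (U : Matrix q p) (V : Matrix p q) → ∀ i j → sum (λ k → U i k * V k j) ≈ δ i j

  private
    module Elimination {q p} (U : Matrix (suc q) (suc p)) (V : Matrix (suc p) (suc q))
                       (UV≈I : ∀ i j → sum (λ k → U i k * V k j) ≈ δ i j)
                       (k : Fin (suc p)) (β : Carrier) (αβ≈1 : U zero k * β ≈ 1#) where
      open import Algebra.Solver.Ring.NaturalCoefficients.Default commutativeSemiring
        using (solve; _:+_; _:*_; _:=_)
      open import Algebra.Properties.Ring ring using (-‿distribˡ-*)

      α : Carrier
      α = U zero k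

      multiplier : Fin q → Carrier
      multiplier i = - (U (suc i) k * β)

      U′ : Matrix q p
      U′ i k′ = U (suc i) (punchIn k k′) + multiplier i * U zero (punchIn k k′)

      V′ : Matrix p q
      V′ k′ j = V (punchIn k k′) (suc j)

      pivot-cleared : ∀ i → U (suc i) k + multiplier i * α ≈ 0#
      pivot-cleared i = begin
        u + - (u * β) * α  ≈⟨ +-congˡ (sym (-‿distribˡ-* (u * β) α)) ⟩
        u + - (u * β * α)  ≈⟨ +-congˡ (-‿cong (trans (*-assoc u β α) uβα≈u)) ⟩
        u + - u            ≈⟨ -‿inverseʳ u ⟩
        0#                 ∎
        where
        u : Carrier
        u = U (suc i) k
        uβα≈u : u * (β * α) ≈ u
        uβα≈u = trans (*-congˡ (trans (*-comm β α) αβ≈1)) (*-identityʳ u)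

      distributeRow : ∀ a ν b w → (a + ν * b) * w ≈ a * w + ν * (b * w)
      distributeRow = solve 4 (λ a ν b w → (a :+ ν :* b) :* w := a :* w :+ ν :* (b :* w)) refl

      pivotIdentity : ∀ u v α ν Sᵢ S₀ →
                      Sᵢ + ν * S₀ + v * (u + ν * α) ≈ (u * v + Sᵢ) + ν * (α * v + S₀)
      pivotIdentity = solve 6 (λ u v α ν Sᵢ S₀ →
        Sᵢ :+ ν :* S₀ :+ v :* (u :+ ν :* α) := (u :* v :+ Sᵢ) :+ ν :* (α :* v :+ S₀)) refl

      x+y*0≈x : ∀ x y → x + y * 0# ≈ x
      x+y*0≈x x y = trans (+-congˡ (zeroʳ y)) (+-identityʳ x)

      U′V′≈I : ∀ i j → sum (λ k′ → U′ i k′ * V′ k′ j) ≈ δ i j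
      U′V′≈I i j = begin
        sum (λ k′ → U′ i k′ * V′ k′ j)
          ≈⟨ sum-cong-≋ (λ k′ → distributeRow _ ν _ (V′ k′ j)) ⟩
        sum (λ k′ → rowᵢ (punchIn k k′) + ν * row₀ (punchIn k k′))
          ≈⟨ ∑-distrib-+ (rowᵢ ∘ punchIn k) (λ k′ → ν * row₀ (punchIn k k′)) ⟩
        Sᵢ + sum (λ k′ → ν * row₀ (punchIn k k′))
          ≈⟨ +-congˡ (sym (*-distribˡ-sum ν (row₀ ∘ punchIn k))) ⟩
        Sᵢ + ν * S₀
          ≈⟨ sym (x+y*0≈x _ v) ⟩
        Sᵢ + ν * S₀ + v * 0#
          ≈⟨ +-congˡ (*-congˡ (sym (pivot-cleared i))) ⟩
        Sᵢ + ν * S₀ + v * (u + ν * α)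
          ≈⟨ pivotIdentity u v α ν Sᵢ S₀ ⟩
        (u * v + Sᵢ) + ν * (α * v + S₀)
          ≈⟨ +-cong (trans (sym (sum-remove {i = k} rowᵢ)) (UV≈I (suc i) (suc j)))
                    (*-congˡ (trans (sym (sum-remove {i = k} row₀)) (UV≈I zero (suc j)))) ⟩
        δ i j + ν * 0#
          ≈⟨ x+y*0≈x (δ i j) ν ⟩
        δ i j ∎
        where
        u v ν Sᵢ S₀ : Carrier
        u = U (suc i) k
        v = V k (suc j)
        ν = multiplier i
        rowᵢ row₀ : Fin (suc p) → Carrier
        rowᵢ k″ = U (suc i) k″ * V k″ (suc j)
        row₀ k″ = U zero k″ * V k″ (suc j)
        Sᵢ = sum (rowᵢ ∘ punchIn k)
        S₀ = sum (row₀ ∘ punchIn k)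

  eliminatePivot : ∀ {q p} (U : Matrix (suc q) (suc p)) (V : Matrix (suc p) (suc q)) →
                   (∀ i j → sum (λ k → U i k * V k j) ≈ δ i j) →
                   ∀ k → ¬ (U zero k ≈ 0#) → IdentityFactorsThrough q p
  eliminatePivot U V UV≈I k α≉0 with β , αβ≈1 ← inverse (U zero k) α≉0 = U′ , V′ , U′V′≈I
    where open Elimination U V UV≈I k β αβ≈1

  -- Equality in F need not be decidable, so a nonzero pivot in the first row of U exists only under
  -- double negation; this suffices because q ≤ p is decidable, hence stable.
  identityFactorsThrough⇒≤ : ∀ {q p} → IdentityFactorsThrough q p → q ≤ p
  identityFactorsThrough⇒≤ {zero}          _              = z≤n
  identityFactorsThrough⇒≤ {suc q} {zero}  (_ , _ , UV≈I) = ⊥-elim (0≉1 (UV≈I zero zero))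
  identityFactorsThrough⇒≤ {suc q} {suc p} (U , V , UV≈I) =
    s≤s (decidable-stable (q ℕ.≤? p) λ q≰p →
      ¬¬-∀-Fin (λ k α≉0 → q≰p (identityFactorsThrough⇒≤ (eliminatePivot U V UV≈I k α≉0))) firstRow≉0)
    where
    firstRow≉0 : ¬ (∀ k → U zero k ≈ 0#)
    firstRow≉0 U₀≈0 =
      0≉1 (trans (sym (sum-zero (λ k → trans (*-congʳ (U₀≈0 k)) (zeroˡ (V k zero))))) (UV≈I zero zero))

module DoubleCosets {c ℓ} (F : Field c ℓ) where
  open Field F hiding (zero)
  open FieldTheory F
  open FiniteSums semiring
  open Rank F
  open import Relation.Binary.Reasoning.Setoid setoid
  open import Algebra.Properties.CommutativeSemigroup *-commutativeSemigroup using (x∙yz≈y∙xz)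

  ∑≡sum : ∀ {n} (f : Fin n → Carrier) → ∑ f ≡ sum f
  ∑≡sum {zero}  f = ≡.refl
  ∑≡sum {suc n} f = ≡.cong (f zero +_) (∑≡sum (f ∘ suc))

  δ-refl : ∀ {n} (i : Fin n) → δ i i ≈ 1#
  δ-refl i = reflexive (if-yes (toℕ i ℕ.≟ toℕ i) ≡.refl)

  δ-≢ : ∀ {n} {i j : Fin n} → i ≢ j → δ i j ≈ 0#
  δ-≢ {i = i} {j} i≢j = reflexive (if-no (toℕ i ℕ.≟ toℕ j) (i≢j ∘ Fin.toℕ-injective))

  sum-δˡ : ∀ {n} (i : Fin n) (f : Fin n → Carrier) → sum (λ k → δ i k * f k) ≈ f i
  sum-δˡ i f = begin
    sum (λ k → δ i k * f k)  ≈⟨ sum-single {f = λ k → δ i k * f k} i off-diagonal ⟩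
    δ i i * f i              ≈⟨ *-congʳ (δ-refl i) ⟩
    1# * f i                 ≈⟨ *-identityˡ (f i) ⟩
    f i                      ∎
    where
    off-diagonal : ∀ k → k ≢ i → δ i k * f k ≈ 0#
    off-diagonal k k≢i = trans (*-congʳ (δ-≢ (k≢i ∘ ≡.sym))) (zeroˡ (f k))

  sum-δʳ : ∀ {n} (i : Fin n) (f : Fin n → Carrier) → sum (λ k → f k * δ k i) ≈ f i
  sum-δʳ i f = begin
    sum (λ k → f k * δ k i)  ≈⟨ sum-single {f = λ k → f k * δ k i} i off-diagonal ⟩
    f i * δ i i              ≈⟨ *-congˡ (δ-refl i) ⟩
    f i * 1#                 ≈⟨ *-identityʳ (f i) ⟩
    f i                      ∎
    where
    off-diagonal : ∀ k → k ≢ i → f k * δ k i ≈ 0#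
    off-diagonal k k≢i = trans (*-congˡ (δ-≢ k≢i)) (zeroʳ (f k))

  _⋆_ : ∀ {N} → (Fin N → Carrier) → Mat N → Fin N → Carrier
  (x ⋆ A) j = sum (λ k → x k * A k j)

  ⊗≡⋆ : ∀ {N} (A B : Mat N) i j → (A ⊗ B) i j ≡ (A i ⋆ B) j
  ⊗≡⋆ A B i j = ∑≡sum (λ k → A i k * B k j)

  ⋆-congˡ : ∀ {N} {x y : Fin N → Carrier} (A : Mat N) → (∀ k → x k ≈ y k) →
            ∀ j → (x ⋆ A) j ≈ (y ⋆ A) j
  ⋆-congˡ A x≈y j = sum-cong-≋ (λ k → *-congʳ (x≈y k))

  ⋆-congʳ : ∀ {N} (x : Fin N → Carrier) {A B : Mat N} → A ≈M B → ∀ j → (x ⋆ A) j ≈ (x ⋆ B) j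
  ⋆-congʳ x A≈B j = sum-cong-≋ (λ k → *-congˡ (A≈B k j))

  ⋆-*ˡ : ∀ {N} d (x : Fin N → Carrier) (A : Mat N) j → ((λ k → d * x k) ⋆ A) j ≈ d * (x ⋆ A) j
  ⋆-*ˡ d x A j =
    trans (sum-cong-≋ (λ k → *-assoc d (x k) (A k j))) (sym (*-distribˡ-sum d (λ k → x k * A k j)))

  ⋆-single : ∀ {N} {x : Fin N → Carrier} i (A : Mat N) → (∀ k → k ≢ i → x k ≈ 0#) →
             ∀ j → (x ⋆ A) j ≈ x i * A i j
  ⋆-single i A x≈0 j = sum-single i (λ k k≢i → trans (*-congʳ (x≈0 k k≢i)) (zeroˡ (A k j)))

  kron-combine : ∀ {m n} (h : Mat m) (g : Mat n) a o α β →
                 kron h g (combine a o) (combine α β) ≡ h a α * g o β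
  kron-combine {m} {n} h g a o α β =
    ≡.cong₂ _*_ (≡.cong₂ h (≡.cong proj₁ ao) (≡.cong proj₁ αβ))
                (≡.cong₂ g (≡.cong proj₂ ao) (≡.cong proj₂ αβ))
    where
    ao : Fin.remQuot n (combine a o) ≡ (a , o)
    ao = Fin.remQuot-combine {m} {n} a o
    αβ : Fin.remQuot n (combine α β) ≡ (α , β)
    αβ = Fin.remQuot-combine {m} {n} α β

  ⋆-kron : ∀ {m n} (y : Fin (m ℕ.* n) → Carrier) (h : Mat m) (g : Mat n) α β →
           (y ⋆ kron h g) (combine α β) ≈ sum (λ a → h a α * sum (λ o → y (combine a o) * g o β))
  ⋆-kron {m} {n} y h g α β = begin
    (y ⋆ kron h g) (combine α β)
      ≈⟨ sum-combine m {n} (λ k → y k * kron h g k (combine α β)) ⟩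
    sum (λ a → sum (λ o → Y a o * kron h g (combine a o) (combine α β)))
      ≡⟨ sum-cong-≗ (λ a → sum-cong-≗ (λ o → ≡.cong (Y a o *_) (kron-combine h g a o α β))) ⟩
    sum (λ a → sum (λ o → Y a o * (h a α * g o β)))
      ≈⟨ sum-cong-≋ (λ a → trans (sum-cong-≋ (λ o → x∙yz≈y∙xz (Y a o) (h a α) (g o β)))
                                 (sym (*-distribˡ-sum (h a α) (λ o → Y a o * g o β)))) ⟩
    sum (λ a → h a α * sum (λ o → Y a o * g o β)) ∎
    where
    Y : Fin m → Fin n → Carrier
    Y a o = y (combine a o)

  ⋆-kronI : ∀ {m n} (y : Fin (m ℕ.* n) → Carrier) α β →
            (y ⋆ kron {m} {n} I I) (combine α β) ≈ y (combine α β)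
  ⋆-kronI {m} {n} y α β = begin
    (y ⋆ kron {m} {n} I I) (combine α β)  ≈⟨ ⋆-kron {m} {n} y I I α β ⟩
    sum (λ a → δ a α * Z a)               ≈⟨ sum-cong-≋ (λ a → *-comm (δ a α) (Z a)) ⟩
    sum (λ a → Z a * δ a α)               ≈⟨ sum-δʳ α Z ⟩
    Z α                                   ≈⟨ sum-δʳ β (λ o → y (combine α o)) ⟩
    y (combine α β)                       ∎
    where
    Z : Fin m → Carrier
    Z a = sum (λ o → y (combine a o) * δ o β)

  I⊗I≈I : ∀ {N} → (I {N} ⊗ I) ≈M I
  I⊗I≈I i j = trans (reflexive (⊗≡⋆ I I i j)) (sum-δˡ i (λ k → I k j))

  I∈GL : ∀ {N} → InGL (I {N})
  I∈GL = I , I⊗I≈I , I⊗I≈I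

  I∈P : ∀ {N} → InP (I {N})
  I∈P = I∈GL , λ i j i≡last j<last →
    δ-≢ (λ i≡j → ℕ.<-irrefl (≡.trans (≡.sym (≡.cong toℕ i≡j)) i≡last) j<last)

  kronI∈T : ∀ {m n} → InT m n (kron {m} {n} I I)
  kronI∈T = I , I , I∈GL , I∈GL , λ _ _ → refl

  σw-last : ∀ {N j} → j ≤ N → σw N j (N ℕ.∸ 1) ≡ j ℕ.∸ 1
  σw-last {N} {j} j≤N = ≡.trans (if-no (N ℕ.∸ 1 ℕ.<? j ℕ.∸ 1) (ℕ.≤⇒≯ (ℕ.∸-monoˡ-≤ 1 j≤N)))
                                (if-no (N ℕ.∸ 1 ℕ.<? N ℕ.∸ 1) (ℕ.<-irrefl ≡.refl))

  w-lastRow : ∀ {N j} {last c : Fin N} → toℕ last ≡ N ℕ.∸ 1 → toℕ c ≡ j ℕ.∸ 1 → j ≤ N →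
              ∀ k → w j last k ≡ δ c k
  w-lastRow {N} {j} {last} {c} last≡ c≡ j≤N k rewrite last≡ | σw-last {N} {j} j≤N =
    if-⇔ (toℕ k ℕ.≟ j ℕ.∸ 1) (toℕ c ℕ.≟ toℕ k)
         (λ k≡ → ≡.trans c≡ (≡.sym k≡)) (λ c≡k → ≡.trans (≡.sym c≡k) c≡)

  u-row : ∀ {N} j v {c : Fin N} → toℕ c ≡ j ℕ.∸ 1 →
          ∀ k → u j v c k ≡ (if does (j ℕ.≤? toℕ k) then v (toℕ k ℕ.∸ j) else δ c k)
  u-row j v {c} c≡ k = ≡.cong (λ isRow → if isRow ∧ does (j ℕ.≤? toℕ k) then v (toℕ k ℕ.∸ j) else δ c k)
                              (dec-true (toℕ c ℕ.≟ j ℕ.∸ 1) c≡)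

  lastRow-product : ∀ {N} j v (p t : Mat N) {last c : Fin N} → toℕ last ≡ N ℕ.∸ 1 → toℕ c ≡ j ℕ.∸ 1 →
    j ≤ N → (∀ k → k ≢ last → p last k ≈ 0#) →
    ∀ J → (((p ⊗ w j) ⊗ u j v) ⊗ t) last J ≈ p last last * (u j v c ⋆ t) J
  lastRow-product j v p t {last} {c} last≡ c≡ j≤N p-last J = begin
    (((p ⊗ w j) ⊗ u j v) ⊗ t) last J  ≡⟨ ⊗≡⋆ ((p ⊗ w j) ⊗ u j v) t last J ⟩
    (((p ⊗ w j) ⊗ u j v) last ⋆ t) J  ≈⟨ ⋆-congˡ t row₂ J ⟩
    ((λ k → d * u j v c k) ⋆ t) J     ≈⟨ ⋆-*ˡ d (u j v c) t J ⟩
    d * (u j v c ⋆ t) J               ∎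
    where
    d : Carrier
    d = p last last
    row₁ : ∀ k → (p ⊗ w j) last k ≈ d * δ c k
    row₁ k = begin
      (p ⊗ w j) last k  ≡⟨ ⊗≡⋆ p (w j) last k ⟩
      (p last ⋆ w j) k  ≈⟨ ⋆-single last (w j) p-last k ⟩
      d * w j last k    ≡⟨ ≡.cong (d *_) (w-lastRow last≡ c≡ j≤N k) ⟩
      d * δ c k         ∎
    row₂ : ∀ k → ((p ⊗ w j) ⊗ u j v) last k ≈ d * u j v c k
    row₂ k = begin
      ((p ⊗ w j) ⊗ u j v) last k       ≡⟨ ⊗≡⋆ (p ⊗ w j) (u j v) last k ⟩
      ((p ⊗ w j) last ⋆ u j v) k       ≈⟨ ⋆-congˡ (u j v) row₁ k ⟩
      ((λ k′ → d * δ c k′) ⋆ u j v) k  ≈⟨ ⋆-*ˡ d (δ c) (u j v) k ⟩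
      d * (δ c ⋆ u j v) k              ≈⟨ *-congˡ (sum-δˡ c (λ k′ → u j v k′ k)) ⟩
      d * u j v c k                    ∎

  InC⇒lastRow : ∀ {m n j v g} {last c : Fin (m ℕ.* n)} → toℕ last ≡ m ℕ.* n ℕ.∸ 1 → toℕ c ≡ j ℕ.∸ 1 →
    j ≤ m ℕ.* n → InC m n j v g → ∃₂ λ (H : Mat m) (G : Mat n) → ∀ α β →
      g last (combine α β) ≈ sum (λ a → H a α * sum (λ o → u j v c (combine a o) * G o β))
  InC⇒lastRow {m} {n} {j} {v} {g} {last} {c} last≡ c≡ j≤N
              (p , t , (_ , p-zero) , (h , G , _ , _ , t≈hG) , g≈) =
    (λ a α → d * h a α) , G , λ α β → begin
      g last (combine α β)                          ≈⟨ g≈ last (combine α β) ⟩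
      (((p ⊗ w j) ⊗ u j v) ⊗ t) last (combine α β)  ≈⟨ lastRow-product j v p t last≡ c≡ j≤N p-last _ ⟩
      d * (y ⋆ t) (combine α β)                     ≈⟨ *-congˡ (⋆-congʳ y t≈hG _) ⟩
      d * (y ⋆ kron h G) (combine α β)              ≈⟨ *-congˡ (⋆-kron y h G α β) ⟩
      d * sum (λ a → h a α * Z a β)                 ≈⟨ *-distribˡ-sum d (λ a → h a α * Z a β) ⟩
      sum (λ a → d * (h a α * Z a β))               ≈⟨ sum-cong-≋ (λ a → sym (*-assoc d (h a α) (Z a β))) ⟩
      sum (λ a → d * h a α * Z a β)                 ∎
    where
    d : Carrier
    d = p last last
    y : Fin (m ℕ.* n) → Carrier
    y = u j v c
    Z : Fin m → Fin n → Carrier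
    Z a β = sum (λ o → y (combine a o) * G o β)
    p-last : ∀ k → k ≢ last → p last k ≈ 0#
    p-last k k≢last = p-zero last k last≡ (ℕ.≤∧≢⇒< (ℕ.<⇒≤pred (Fin.toℕ<n k))
      (λ k≡ → k≢last (Fin.toℕ-injective (≡.trans k≡ (≡.sym last≡)))))

  identityMinor⇒≤ : ∀ {m n q} d p (eq : d ℕ.+ p ≡ m) (H : Mat m) (Y : Fin m → Fin n → Carrier) (G : Mat n) →
    (∀ a o → toℕ a < d → Y a o ≈ 0#) → (α : Fin q → Fin m) (β : Fin q → Fin n) →
    (∀ t t′ → sum (λ a → H a (α t) * sum (λ o → Y a o * G o (β t′))) ≈ δ t t′) → q ≤ p
  identityMinor⇒≤ {q = q} d p eq H Y G Y≈0 α β minor≈I = identityFactorsThrough⇒≤ (U , V , UV≈I)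
    where
    ι : Fin p → Fin _
    ι s = cast eq (d ↑ʳ s)
    U : Matrix q p
    U t s = H (ι s) (α t)
    V : Matrix p q
    V s t′ = sum (λ o → Y (ι s) o * G o (β t′))
    UV≈I : ∀ t t′ → sum (λ s → U t s * V s t′) ≈ δ t t′
    UV≈I t t′ = trans (sym (sum-dropInitial d eq _ vanish)) (minor≈I t t′)
      where
      vanish : ∀ a → toℕ a < d → H a (α t) * sum (λ o → Y a o * G o (β t′)) ≈ 0#
      vanish a a<d = trans (*-congˡ (sum-zero (λ o → trans (*-congʳ (Y≈0 a o a<d)) (zeroˡ _)))) (zeroʳ _)

  b-block : ∀ n {l s x} → s < l → x < n → b n l (s ℕ.* n ℕ.+ x) ≡ e (n ℕ.∸ suc s) x
  b-block n {suc l} {s} {x} s<1+l x<n with ℕ.m≤n⇒m<n∨m≡n (ℕ.≤-pred s<1+l)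
  ... | inj₁ s<l    = ≡.trans (if-yes (s ℕ.* n ℕ.+ x ℕ.<? l ℕ.* n) (blockIndex< n s<l x<n)) (b-block n s<l x<n)
  ... | inj₂ ≡.refl = ≡.trans (if-no (s ℕ.* n ℕ.+ x ℕ.<? s ℕ.* n) (ℕ.m+n≮m (s ℕ.* n) x))
                              (≡.cong (e (n ℕ.∸ suc s)) (ℕ.m+n∸m≡n (s ℕ.* n) x))

  u-block : ∀ n1 {A l N} {c k : Fin N} {t x} → toℕ c ≡ suc A ℕ.* suc n1 ℕ.∸ 1 →
    toℕ k ≡ suc n1 ℕ.* (A ℕ.+ t) ℕ.+ x → t ≤ l → x ≤ n1 →
    u (suc A ℕ.* suc n1) (b (suc n1) l) c k ≡ e (suc n1 ℕ.∸ t) x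
  u-block n1 {A} {l} {c = c} {k} {zero} {x} c≡ k≡ _ x≤n1 =
    ≡.trans (u-row j (b (suc n1) l) c≡ k) (≡.trans (if-no (j ℕ.≤? toℕ k) (ℕ.<⇒≱ k<j))
            (if-⇔ (toℕ c ℕ.≟ toℕ k) (suc x ℕ.≟ suc n1) c≡k⇒x≡n1 x≡n1⇒c≡k))
    where
    j : ℕ
    j = suc A ℕ.* suc n1
    k<j : toℕ k < j
    k<j = s≤s (≡.subst₂ _≤_ (≡.sym k≡) (≡.sym (lastOfBlock n1 A))
                        (ℕ.+-monoʳ-≤ (suc n1 ℕ.* (A ℕ.+ 0)) x≤n1))
    c≡k⇒x≡n1 : toℕ c ≡ toℕ k → suc x ≡ suc n1
    c≡k⇒x≡n1 c≡k = ≡.cong suc (ℕ.+-cancelˡ-≡ (suc n1 ℕ.* (A ℕ.+ 0)) x n1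
      (≡.trans (≡.sym k≡) (≡.trans (≡.sym c≡k) (≡.trans c≡ (lastOfBlock n1 A)))))
    x≡n1⇒c≡k : suc x ≡ suc n1 → toℕ c ≡ toℕ k
    x≡n1⇒c≡k ≡.refl = ≡.trans c≡ (≡.trans (lastOfBlock n1 A) (≡.sym k≡))
  u-block n1 {A} {l} {c = c} {k} {suc s} {x} c≡ k≡ 1+s≤l x≤n1 =
    ≡.trans (u-row j (b (suc n1) l) c≡ k) (≡.trans (if-yes (j ℕ.≤? toℕ k) j≤k)
            (≡.trans (≡.cong (b (suc n1) l) k∸j≡) (b-block (suc n1) 1+s≤l (s≤s x≤n1))))
    where
    j : ℕ
    j = suc A ℕ.* suc n1
    k≡j+ : toℕ k ≡ j ℕ.+ (s ℕ.* suc n1 ℕ.+ x)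
    k≡j+ = ≡.trans k≡ (laterBlock n1 A s x)
    j≤k : j ≤ toℕ k
    j≤k = ≡.subst (j ≤_) (≡.sym k≡j+) (ℕ.m≤m+n j _)
    k∸j≡ : toℕ k ℕ.∸ j ≡ s ℕ.* suc n1 ℕ.+ x
    k∸j≡ = ≡.trans (≡.cong (ℕ._∸ j) k≡j+) (ℕ.m+n∸m≡n j _)

  u-identityMinor : ∀ n1 {A l} {c : Fin ((A ℕ.+ suc l) ℕ.* suc n1)} → l ≤ n1 →
    toℕ c ≡ suc A ℕ.* suc n1 ℕ.∸ 1 →
    ∀ t t′ → u (suc A ℕ.* suc n1) (b (suc n1) l) c (combine (minorRow A t) (minorCol n1 t′)) ≈ δ t t′
  u-identityMinor n1 {A} l≤n1 c≡ t t′ = reflexive (≡.trans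
    (u-block n1 c≡ k≡ (ℕ.≤-pred (Fin.toℕ<n t)) (ℕ.m∸n≤m n1 (toℕ t′)))
    (if-⇔ (suc (n1 ℕ.∸ toℕ t′) ℕ.≟ suc n1 ℕ.∸ toℕ t) (toℕ t ℕ.≟ toℕ t′)
          (reflectedIndex-injective t≤n1 t′≤n1)
          (λ t≡t′ → ≡.subst (λ z → suc (n1 ℕ.∸ z) ≡ suc n1 ℕ.∸ toℕ t) t≡t′
                            (reflectedIndex-refl t≤n1))))
    where
    t≤n1 : toℕ t ≤ n1
    t≤n1 = ℕ.≤-trans (ℕ.≤-pred (Fin.toℕ<n t)) l≤n1
    t′≤n1 : toℕ t′ ≤ n1
    t′≤n1 = ℕ.≤-trans (ℕ.≤-pred (Fin.toℕ<n t′)) l≤n1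
    k≡ : toℕ (combine (minorRow A t) (minorCol n1 t′)) ≡ suc n1 ℕ.* (A ℕ.+ toℕ t) ℕ.+ (n1 ℕ.∸ toℕ t′)
    k≡ = ≡.trans (Fin.toℕ-combine (minorRow A t) (minorCol n1 t′))
                 (≡.cong₂ (λ a o → suc n1 ℕ.* a ℕ.+ o) (toℕ-minorRow A t) (toℕ-minorCol n1 t′))

  u-beforePivot : ∀ {N} j v {c k : Fin N} → toℕ c ≡ j ℕ.∸ 1 → toℕ k < j ℕ.∸ 1 → u j v c k ≈ 0#
  u-beforePivot j v {c} {k} c≡ k<c = reflexive (≡.trans (u-row j v c≡ k)
    (≡.trans (if-no (j ℕ.≤? toℕ k) (ℕ.<⇒≱ (ℕ.<-≤-trans k<c (ℕ.m∸n≤m j 1))))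
             (if-no (toℕ c ℕ.≟ toℕ k) (λ c≡k → ℕ.<-irrefl (≡.trans (≡.sym c≡k) c≡) k<c))))

  u-beforePivotBlock : ∀ n1 {m Ar} v {c : Fin (m ℕ.* suc n1)} → toℕ c ≡ suc Ar ℕ.* suc n1 ℕ.∸ 1 →
    ∀ (a : Fin m) (o : Fin (suc n1)) → toℕ a < Ar → u (suc Ar ℕ.* suc n1) v c (combine a o) ≈ 0#
  u-beforePivotBlock n1 {Ar = Ar} v c≡ a o a<Ar = u-beforePivot (suc Ar ℕ.* suc n1) v c≡
    (≡.subst (_< n1 ℕ.+ Ar ℕ.* suc n1) (≡.sym (Fin.toℕ-combine a o))
             (earlierBlock n1 a<Ar (ℕ.≤-pred (Fin.toℕ<n o))))

  wu : ∀ {m n} → ℕ → (ℕ → Carrier) → Mat (m ℕ.* n)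
  wu {m} {n} j v = ((I ⊗ w j) ⊗ u j v) ⊗ kron {m} {n} I I

  wu∈C : ∀ {m n} j v → InC m n j v (wu {m} {n} j v)
  wu∈C {m} {n} j v = I , kron {m} {n} I I , I∈P , kronI∈T , λ _ _ → refl

  wu-lastRow : ∀ {m n} j v {last c : Fin (m ℕ.* n)} → toℕ last ≡ m ℕ.* n ℕ.∸ 1 → toℕ c ≡ j ℕ.∸ 1 →
    j ≤ m ℕ.* n → ∀ (a : Fin m) (o : Fin n) → wu {m} {n} j v last (combine a o) ≈ u j v c (combine a o)
  wu-lastRow {m} {n} j v {last} {c} last≡ c≡ j≤N a o = begin
    wu {m} {n} j v last (combine a o)    ≈⟨ lastRow-product j v I K last≡ c≡ j≤N I-last _ ⟩
    δ last last * (y ⋆ K) (combine a o)  ≈⟨ *-congʳ (δ-refl last) ⟩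
    1# * (y ⋆ K) (combine a o)           ≈⟨ *-identityˡ _ ⟩
    (y ⋆ K) (combine a o)                ≈⟨ ⋆-kronI y a o ⟩
    y (combine a o)                      ∎
    where
    K : Mat (m ℕ.* n)
    K = kron {m} {n} I I
    y : Fin (m ℕ.* n) → Carrier
    y = u j v c
    I-last : ∀ k → k ≢ last → δ last k ≈ 0#
    I-last k k≢last = δ-≢ (k≢last ∘ ≡.sym)

  cosetInclusion⇒≤′ : ∀ n1 A Ar l r → Ar ℕ.+ suc r ≡ A ℕ.+ suc l → l ≤ n1 →
    (∀ g → InC (A ℕ.+ suc l) (suc n1) (suc A ℕ.* suc n1) (b (suc n1) l) g →
           InC (A ℕ.+ suc l) (suc n1) (suc Ar ℕ.* suc n1) (b (suc n1) r) g) → l ≤ r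
  cosetInclusion⇒≤′ n1 A Ar l r eq l≤n1 incl =
    let H , G , lastRow = InC⇒lastRow {m} {n} {v = b n r} {last = last} {c = cr} toℕ-last toℕ-cr jr≤N
                                       (incl (wu {m} {n} jl (b n l)) (wu∈C jl (b n l)))
    in ℕ.≤-pred (identityMinor⇒≤ Ar (suc r) eq H (λ a o → u jr (b n r) cr (combine a o)) G
                                  (u-beforePivotBlock n1 (b n r) toℕ-cr) (minorRow A) (minorCol n1)
                                  λ t t′ → trans (sym (lastRow _ _))
                                                 (trans (wu-lastRow {m} {n} jl (b n l) toℕ-last toℕ-cl jl≤N _ _)
                                                        (u-identityMinor n1 {A} l≤n1 toℕ-cl t t′)))
    where
    m n N jl jr : ℕ
    m  = A ℕ.+ suc l
    n  = suc n1
    N  = m ℕ.* n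
    jl = suc A ℕ.* n
    jr = suc Ar ℕ.* n
    jl≤N : jl ≤ N
    jl≤N = ℕ.*-monoˡ-≤ n (suc≤+suc A l)
    jr≤N : jr ≤ N
    jr≤N = ℕ.*-monoˡ-≤ n (≡.subst (suc Ar ≤_) eq (suc≤+suc Ar r))
    last cl cr : Fin N
    last = fromℕ< (∸1< (ℕ.≤-trans (s≤s z≤n) jl≤N) ℕ.≤-refl)
    cl   = fromℕ< (∸1< (s≤s z≤n) jl≤N)
    cr   = fromℕ< (∸1< (s≤s z≤n) jr≤N)
    toℕ-last : toℕ last ≡ N ℕ.∸ 1
    toℕ-last = Fin.toℕ-fromℕ< _
    toℕ-cl : toℕ cl ≡ jl ℕ.∸ 1
    toℕ-cl = Fin.toℕ-fromℕ< _
    toℕ-cr : toℕ cr ≡ jr ℕ.∸ 1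
    toℕ-cr = Fin.toℕ-fromℕ< _

  cosetInclusion⇒≤ : ∀ m n1 l r → l ≤ n1 → r ≤ n1 → suc n1 ≤ m →
    (∀ g → InC m (suc n1) ((m ℕ.∸ l) ℕ.* suc n1) (b (suc n1) l) g →
           InC m (suc n1) ((m ℕ.∸ r) ℕ.* suc n1) (b (suc n1) r) g) → l ≤ r
  cosetInclusion⇒≤ m n1 l r l≤n1 r≤n1 n≤m incl
    with A , ≡.refl , m∸l≡1+A ← ∸-decomposition (ℕ.≤-trans (s≤s l≤n1) n≤m)
       | Ar , Ar+1+r≡m , m∸r≡1+Ar ← ∸-decomposition (ℕ.≤-trans (s≤s r≤n1) n≤m)
    rewrite m∸l≡1+A | m∸r≡1+Ar = cosetInclusion⇒≤′ n1 A Ar l r Ar+1+r≡m l≤n1 incl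

lemma2p5 : ∀ {c ℓ : Level} (F : Field c ℓ) → FieldTheory.IsNumberField F →
    (m n r l : ℕ) → 1 ≤ n → n ≤ m → r ≤ n ℕ.∸ 1 → l ≤ n ℕ.∸ 1 → r ≢ l →
    ¬ (∀ g → (FieldTheory.InC F m n ((m ℕ.∸ r) ℕ.* n) (FieldTheory.b F n r) g →
              FieldTheory.InC F m n ((m ℕ.∸ l) ℕ.* n) (FieldTheory.b F n l) g)
           × (FieldTheory.InC F m n ((m ℕ.∸ l) ℕ.* n) (FieldTheory.b F n l) g →
              FieldTheory.InC F m n ((m ℕ.∸ r) ℕ.* n) (FieldTheory.b F n r) g))
lemma2p5 F _ m (suc n1) r l (s≤s z≤n) n≤m r≤n1 l≤n1 r≢l Cr≡Cl = r≢l (ℕ.≤-antisym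
  (DoubleCosets.cosetInclusion⇒≤ F m n1 r l r≤n1 l≤n1 n≤m (proj₁ ∘ Cr≡Cl))
  (DoubleCosets.cosetInclusion⇒≤ F m n1 l r l≤n1 r≤n1 n≤m (proj₂ ∘ Cr≡Cl)))
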